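{- Fix an integer $s\ge 0$ and let $h_s$ be the sequence defined by $h_s(1)=h_s(2)=\cdots=h_s(s+2)=1$, $h_s(s+3)=2$, and $$h_s(n)=h_s\bigl(n-s-h_s(n-1)\bigr)+h_s\bigl(n-2-s-h_s(n-3)\bigr),\qquad n>s+3.$$ Then for every positive integer $n$, $h_s(n)=a_s(n)$, i.e. $h_s(n)$ equals the number of leaves of $\mathcal{T}_s$ among the nodes carrying a label at most $n$.
   Context: Fix an integer $s\ge 0$. Let $\mathcal{T}_s$ be the following infinite graph. It has super-nodes (level 0 nodes) $s_1,s_2,s_3,\dots$, with $s_{i+1}$ adjacent to $s_i$ for each $i\ge1$. Each super-node $s_i$ has $2^{i-1}$ children (level 1 nodes), called in left-to-right order the 1st, 2nd, $\dots$, $2^{i-1}$th child of $s_i$. Each level 1 node has exactly one child, a level 2 node, and level 2 nodes have no children. In addition there is one isolated node $I$. The leaves of $\mathcal{T}_s$ are the level 2 nodes together with $I$. Nodes are labelled by positive integers as follows: $I$ gets label $1$; then for $i=1,2,3,\dots$ in turn, the super-node $s_i$ receives the next $s$ consecutive unused labels (no label at all if $s=0$), and then for $r=1,2,\dots,2^{i-1}$ in turn, the $r$th child of $s_i$ receives the next unused label and then its child (a leaf) receives the next unused label. Thus each positive integer labels exactly one node; $I$ and all level 1 and level 2 nodes get exactly one label, and each super-node gets $s$ labels. For $n\ge1$ let $v_s(n)$ be the node with label $n$, let $d_s(n)=1$ if $v_s(n)$ is a leaf and $d_s(n)=0$ otherwise, and let $a_s(n)=\sum_{k=1}^n d_s(k)$.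 -}

module Defs where

open import Data.Nat using (ℕ; zero; suc; _+_; _∸_; _^_; _≤_; _<_)
open import Data.List using (List; []; _∷_; _++_; replicate; concatMap; applyUpTo; map)
open import Data.Nat.ListAction using (sum)
open import Data.Maybe using (Maybe; just; nothing)
open import Data.Product using (_×_)

data Node : Set where
  I    : Node               -- the isolated node
  sup  : ℕ → Node
  lvl1 : ℕ → ℕ → Node       -- r-th child of s_i  (lvl1 i r)
  lvl2 : ℕ → ℕ → Node       -- the child of (lvl1 i r)

isLeaf : Node → ℕ
isLeaf I          = 1
isLeaf (sup _)    = 0
isLeaf (lvl1 _ _) = 0
isLeaf (lvl2 _ _) = 1

block : ℕ → ℕ → List Node
block s i = replicate s (sup i)
         ++ concatMap (λ r → lvl1 i r ∷ lvl2 i r ∷ []) (applyUpTo suc (2 ^ (i ∸ 1)))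

labelOrder : ℕ → ℕ → List Node
labelOrder s k = I ∷ concatMap (block s) (applyUpTo suc k)

nth : {A : Set} → List A → ℕ → Maybe A
nth []       _       = nothing
nth (x ∷ xs) zero    = just x
nth (x ∷ xs) (suc n) = nth xs n

-- v_s(n): the node with label n (n ≥ 1).  Every stage contributes at least
-- one label, so the first n stages already contain labels 1..n.
v : ℕ → ℕ → Maybe Node
v s n = nth (labelOrder s n) (n ∸ 1)

d : ℕ → ℕ → ℕ
d s n with v s n
... | just x  = isLeaf x
... | nothing = 0

a : ℕ → ℕ → ℕ
a s n = sum (map (d s) (applyUpTo suc n))

-- h satisfies the defining equations of h_s (on positive arguments), with all
-- arguments of the recursion well-defined, i.e. lying in {1, ..., n-1}.
IsHSeq : ℕ → (ℕ → ℕ) → Set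
IsHSeq s h =
    (∀ n → 1 ≤ n → n ≤ s + 2 → h n ≡ 1)
  × h (s + 3) ≡ 2
  × (∀ n → s + 3 < n →
        (1 ≤ n ∸ s ∸ h (n ∸ 1)) × (n ∸ s ∸ h (n ∸ 1) < n)
      × (1 ≤ n ∸ 2 ∸ s ∸ h (n ∸ 3)) × (n ∸ 2 ∸ s ∸ h (n ∸ 3) < n)
      × (h n ≡ h (n ∸ s ∸ h (n ∸ 1)) + h (n ∸ 2 ∸ s ∸ h (n ∸ 3))))
  where open import Relation.Binary.PropositionalEquality using (_≡_)

-- Labels come in stages: stage k+1 consists of the s labels of the super-node
-- s_{k+1} followed by 2^k pairs (level 1 node, level 2 leaf), so it starts after
-- labelsUpTo s k labels, 2^k of which are leaves.  Counting leaves in the label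
-- order gives the closed form (stage-formula, stage-formula⁺)
--     a_s(labelsUpTo s k + u) = 2^k + ⌊(u ∸ s)/2⌋     for u ≤ s + 2^(k+1) + 1.
-- For n > s+3, n lies in some stage k+2 and both look-back arguments of the
-- recurrence land in stage k+1; the recurrence then reduces to an identity for
-- stageLeaves s u = ⌊(u ∸ s)/2⌋ (stageLeaves-recurrence), except at the first
-- two offsets of a stage, where n - 3 falls back into the previous stage and a
-- direct computation is needed (module StageRecurrence).  The initial values
-- are the first stage, and uniqueness is strong induction on n.
module Submission where

open import Defs
open import Data.Nat using (ℕ; zero; suc; _+_; _∸_; _^_; _≤_; _<_; z≤n; s≤s; ⌊_/2⌋; ⌈_/2⌉)
open import Data.Nat.Properties
open import Data.Nat.ListAction using (sum)
open import Data.Nat.Induction using (<-rec)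
open import Data.Nat.ListAction.Properties using (sum-++)
open import Data.List using (List; []; _∷_; _++_; replicate; concatMap; applyUpTo; map; take; length)
open import Data.List.Properties
  using (length-++; length-replicate; length-applyUpTo; ++-assoc; ++-identityʳ; concatMap-++; applyUpTo-∷ʳ; map-++; take-all)
open import Data.Nat.Tactic.RingSolver using (solve-∀)
open import Data.Maybe using (Maybe; just; nothing)
open import Data.Sum using (_⊎_; inj₁; inj₂)
open import Data.Empty using (⊥-elim)
open import Relation.Nullary using (yes; no)
open import Relation.Binary.Definitions using (tri<; tri≈; tri>)
open import Data.Product using (_×_; _,_; ∃; proj₁; proj₂)
open import Relation.Binary.PropositionalEquality using (_≡_; refl; sym; trans; cong; cong₂; subst; module ≡-Reasoning)

leafCount : List Node → ℕ
leafCount []       = 0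
leafCount (x ∷ xs) = isLeaf x + leafCount xs

leafCount-++ : ∀ xs ys → leafCount (xs ++ ys) ≡ leafCount xs + leafCount ys
leafCount-++ []       ys = refl
leafCount-++ (x ∷ xs) ys = trans (cong (isLeaf x +_) (leafCount-++ xs ys)) (sym (+-assoc (isLeaf x) _ _))

take-++ : ∀ {A : Set} n (xs ys : List A) → take n (xs ++ ys) ≡ take n xs ++ take (n ∸ length xs) ys
take-++ zero    []       ys = refl
take-++ zero    (x ∷ xs) ys = refl
take-++ (suc n) []       ys = refl
take-++ (suc n) (x ∷ xs) ys = cong (x ∷_) (take-++ n xs ys)

leafCount-take-++ : ∀ n xs ys →
  leafCount (take n (xs ++ ys)) ≡ leafCount (take n xs) + leafCount (take (n ∸ length xs) ys)
leafCount-take-++ n xs ys = trans (cong leafCount (take-++ n xs ys)) (leafCount-++ (take n xs) _)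

nth-++ : ∀ {A : Set} (xs ys : List A) j → j < length xs → nth (xs ++ ys) j ≡ nth xs j
nth-++ (x ∷ xs) ys zero    _         = refl
nth-++ (x ∷ xs) ys (suc j) (s≤s j<) = nth-++ xs ys j j<

family : ℕ → ℕ → List Node
family i r = lvl1 i r ∷ lvl2 i r ∷ []

labelsUpTo : ℕ → ℕ → ℕ
labelsUpTo s zero    = 1
labelsUpTo s (suc k) = labelsUpTo s k + (s + (2 ^ k + 2 ^ k))

labelOrder-suc : ∀ s k → labelOrder s (suc k) ≡ labelOrder s k ++ block s (suc k)
labelOrder-suc s k = cong (I ∷_) (begin
  concatMap (block s) (applyUpTo suc (suc k))
    ≡⟨ cong (concatMap (block s)) (sym (applyUpTo-∷ʳ suc k)) ⟩
  concatMap (block s) (applyUpTo suc k ++ suc k ∷ [])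
    ≡⟨ concatMap-++ (block s) (applyUpTo suc k) (suc k ∷ []) ⟩
  concatMap (block s) (applyUpTo suc k) ++ block s (suc k) ++ []
    ≡⟨ cong (concatMap (block s) (applyUpTo suc k) ++_) (++-identityʳ (block s (suc k))) ⟩
  concatMap (block s) (applyUpTo suc k) ++ block s (suc k) ∎)
  where open ≡-Reasoning

labelOrder-prefix : ∀ s {k K} → k ≤ K → ∃ λ rest → labelOrder s K ≡ labelOrder s k ++ rest
labelOrder-prefix s {K = zero} z≤n = [] , sym (++-identityʳ (labelOrder s 0))
labelOrder-prefix s {k} {suc K} k≤1+K with m≤n⇒m<n∨m≡n k≤1+K
... | inj₂ refl = [] , sym (++-identityʳ (labelOrder s (suc K)))
... | inj₁ (s≤s k≤K) with labelOrder-prefix s k≤K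
...   | rest , eq = rest ++ block s (suc K) , (begin
  labelOrder s (suc K)                          ≡⟨ labelOrder-suc s K ⟩
  labelOrder s K ++ block s (suc K)             ≡⟨ cong (_++ block s (suc K)) eq ⟩
  (labelOrder s k ++ rest) ++ block s (suc K)   ≡⟨ ++-assoc (labelOrder s k) rest _ ⟩
  labelOrder s k ++ rest ++ block s (suc K)     ∎)
  where open ≡-Reasoning

length-family : ∀ i (rs : List ℕ) → length (concatMap (family i) rs) ≡ length rs + length rs
length-family i []       = refl
length-family i (r ∷ rs) =
  cong suc (trans (cong suc (length-family i rs)) (sym (+-suc (length rs) (length rs))))

length-block : ∀ s k → length (block s (suc k)) ≡ s + (2 ^ k + 2 ^ k)
length-block s k = begin
  length (block s (suc k))
    ≡⟨ length-++ (replicate s (sup (suc k))) ⟩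
  length (replicate s (sup (suc k))) + length (concatMap (family (suc k)) (applyUpTo suc (2 ^ k)))
    ≡⟨ cong₂ _+_ (length-replicate s) (length-family (suc k) (applyUpTo suc (2 ^ k))) ⟩
  s + (length (applyUpTo suc (2 ^ k)) + length (applyUpTo suc (2 ^ k)))
    ≡⟨ cong (λ m → s + (m + m)) (length-applyUpTo suc (2 ^ k)) ⟩
  s + (2 ^ k + 2 ^ k) ∎
  where open ≡-Reasoning

length-labelOrder : ∀ s k → length (labelOrder s k) ≡ labelsUpTo s k
length-labelOrder s zero    = refl
length-labelOrder s (suc k) = begin
  length (labelOrder s (suc k))                      ≡⟨ cong length (labelOrder-suc s k) ⟩
  length (labelOrder s k ++ block s (suc k))         ≡⟨ length-++ (labelOrder s k) ⟩
  length (labelOrder s k) + length (block s (suc k)) ≡⟨ cong₂ _+_ (length-labelOrder s k) (length-block s k) ⟩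
  labelsUpTo s (suc k)                               ∎
  where open ≡-Reasoning

labelsUpTo-> : ∀ s k → k < labelsUpTo s k
labelsUpTo-> s zero    = s≤s z≤n
labelsUpTo-> s (suc k) = subst (_≤ labelsUpTo s (suc k)) (+-comm (suc k) 1)
  (+-mono-≤ (labelsUpTo-> s k) (≤-trans (m^n>0 2 k) (≤-trans (m≤m+n _ _) (m≤n+m _ s))))

leafCount-supers : ∀ s i → leafCount (replicate s (sup i)) ≡ 0
leafCount-supers zero    i = refl
leafCount-supers (suc s) i = leafCount-supers s i

leafCount-family : ∀ i (rs : List ℕ) → leafCount (concatMap (family i) rs) ≡ length rs
leafCount-family i []       = refl
leafCount-family i (r ∷ rs) = cong suc (leafCount-family i rs)

leafCount-labelOrder : ∀ s k → leafCount (labelOrder s k) ≡ 2 ^ k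
leafCount-labelOrder s zero    = refl
leafCount-labelOrder s (suc k) = begin
  leafCount (labelOrder s (suc k))                         ≡⟨ cong leafCount (labelOrder-suc s k) ⟩
  leafCount (labelOrder s k ++ block s (suc k))            ≡⟨ leafCount-++ (labelOrder s k) _ ⟩
  leafCount (labelOrder s k) + leafCount (block s (suc k)) ≡⟨ cong₂ _+_ (leafCount-labelOrder s k) blockLeaves ⟩
  2 ^ k + (2 ^ k + 0)                                      ∎
  where
    open ≡-Reasoning
    blockLeaves : leafCount (block s (suc k)) ≡ 2 ^ k + 0
    blockLeaves = begin
      leafCount (block s (suc k))
        ≡⟨ leafCount-++ (replicate s (sup (suc k))) _ ⟩
      leafCount (replicate s (sup (suc k))) + leafCount (concatMap (family (suc k)) (applyUpTo suc (2 ^ k)))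
        ≡⟨ cong₂ _+_ (leafCount-supers s (suc k)) (leafCount-family (suc k) (applyUpTo suc (2 ^ k))) ⟩
      length (applyUpTo suc (2 ^ k))
        ≡⟨ length-applyUpTo suc (2 ^ k) ⟩
      2 ^ k
        ≡⟨ sym (+-identityʳ (2 ^ k)) ⟩
      2 ^ k + 0 ∎

-- Leaves among the first u labels of a stage: the s labels of the super-node
-- come first and carry no leaf, after them every second label is a leaf.
stageLeaves : ℕ → ℕ → ℕ
stageLeaves s u = ⌊ (u ∸ s) /2⌋

leafCount-take-supers : ∀ s i u ys →
  leafCount (take u (replicate s (sup i) ++ ys)) ≡ leafCount (take (u ∸ s) ys)
leafCount-take-supers zero    i u       ys = refl
leafCount-take-supers (suc s) i zero    ys = refl
leafCount-take-supers (suc s) i (suc u) ys = leafCount-take-supers s i u ys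

leafCount-take-family : ∀ i w (rs : List ℕ) → w ≤ length rs + length rs →
  leafCount (take w (concatMap (family i) rs)) ≡ ⌊ w /2⌋
leafCount-take-family i zero          rs       _ = refl
leafCount-take-family i (suc zero)    (r ∷ rs) _ = refl
leafCount-take-family i (suc (suc w)) (r ∷ rs) (s≤s w≤) =
  cong suc (leafCount-take-family i w rs (≤-pred (subst (suc w ≤_) (+-suc (length rs) (length rs)) w≤)))

leafCount-take-block : ∀ s k u → u ≤ s + (2 ^ k + 2 ^ k) →
  leafCount (take u (block s (suc k))) ≡ stageLeaves s u
leafCount-take-block s k u u≤ = trans (leafCount-take-supers s (suc k) u _)
  (leafCount-take-family (suc k) (u ∸ s) (applyUpTo suc (2 ^ k))
    (subst (λ m → u ∸ s ≤ m + m) (sym (length-applyUpTo suc (2 ^ k))) u∸s≤))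
  where
    u∸s≤ : u ∸ s ≤ 2 ^ k + 2 ^ k
    u∸s≤ = subst (u ∸ s ≤_) (m+n∸m≡n s _) (∸-monoˡ-≤ s u≤)

leafValue : Maybe Node → ℕ
leafValue (just x) = isLeaf x
leafValue nothing  = 0

d≡leafValue : ∀ s n → d s n ≡ leafValue (v s n)
d≡leafValue s n with v s n
... | just x  = refl
... | nothing = refl

a-suc : ∀ s n → a s (suc n) ≡ a s n + d s (suc n)
a-suc s n = begin
  sum (map (d s) (applyUpTo suc (suc n)))                    ≡⟨ cong (λ ns → sum (map (d s) ns)) (sym (applyUpTo-∷ʳ suc n)) ⟩
  sum (map (d s) (applyUpTo suc n ++ suc n ∷ []))            ≡⟨ cong sum (map-++ (d s) (applyUpTo suc n) (suc n ∷ [])) ⟩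
  sum (map (d s) (applyUpTo suc n) ++ d s (suc n) ∷ [])      ≡⟨ sum-++ (map (d s) (applyUpTo suc n)) (d s (suc n) ∷ []) ⟩
  a s n + (d s (suc n) + 0)                                  ≡⟨ cong (a s n +_) (+-identityʳ (d s (suc n))) ⟩
  a s n + d s (suc n)                                        ∎
  where open ≡-Reasoning

leafCount-take-suc : ∀ n xs → leafCount (take (suc n) xs) ≡ leafCount (take n xs) + leafValue (nth xs n)
leafCount-take-suc zero    []       = refl
leafCount-take-suc (suc n) []       = refl
leafCount-take-suc zero    (x ∷ xs) = +-identityʳ (isLeaf x)
leafCount-take-suc (suc n) (x ∷ xs) =
  trans (cong (isLeaf x +_) (leafCount-take-suc n xs)) (sym (+-assoc (isLeaf x) _ _))

a≡leafCount : ∀ s K n → n ≤ K → a s n ≡ leafCount (take n (labelOrder s K))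
a≡leafCount s K zero    _     = refl
a≡leafCount s K (suc n) 1+n≤K = begin
  a s (suc n)                                      ≡⟨ a-suc s n ⟩
  a s n + d s (suc n)                              ≡⟨ cong₂ _+_ (a≡leafCount s K n (<⇒≤ 1+n≤K)) (d≡leafValue s (suc n)) ⟩
  leafCount (take n L) + leafValue (v s (suc n))   ≡⟨ cong (λ m → leafCount (take n L) + leafValue m) labelStable ⟩
  leafCount (take n L) + leafValue (nth L n)       ≡⟨ sym (leafCount-take-suc n L) ⟩
  leafCount (take (suc n) L)                       ∎
  where
    open ≡-Reasoning
    L = labelOrder s K
    prefix = labelOrder-prefix s 1+n≤K
    -- the label n+1 already occurs within the first n+1 stages
    labelStable : nth (labelOrder s (suc n)) n ≡ nth L n
    labelStable = sym (trans (cong (λ xs → nth xs n) (proj₂ prefix))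
      (nth-++ (labelOrder s (suc n)) (proj₁ prefix) n
        (subst (n <_) (sym (length-labelOrder s (suc n))) (<-trans (n<1+n n) (labelsUpTo-> s (suc n))))))

-- Closed form of a_s inside stage k+1: the first k stages (with I) hold 2^k
-- leaves, and the first u labels of stage k+1 hold stageLeaves s u more.
stage-formula : ∀ s k u → u ≤ s + (2 ^ k + 2 ^ k) →
  a s (labelsUpTo s k + u) ≡ 2 ^ k + stageLeaves s u
stage-formula s k u u≤ = begin
  a s N
    ≡⟨ a≡leafCount s N N ≤-refl ⟩
  leafCount (take N (labelOrder s N))
    ≡⟨ cong (λ xs → leafCount (take N xs)) (trans (proj₂ prefix) (cong (_++ rest) (labelOrder-suc s k))) ⟩
  leafCount (take N ((earlier ++ current) ++ rest))
    ≡⟨ cong (λ xs → leafCount (take N xs)) (++-assoc earlier current rest) ⟩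
  leafCount (take N (earlier ++ current ++ rest))
    ≡⟨ leafCount-take-++ N earlier (current ++ rest) ⟩
  leafCount (take N earlier) + leafCount (take (N ∸ length earlier) (current ++ rest))
    ≡⟨ cong₂ (λ xs m → leafCount xs + leafCount (take m (current ++ rest)))
         (take-all N earlier (subst (_≤ N) (sym (length-labelOrder s k)) (m≤m+n _ u)))
         (trans (cong (N ∸_) (length-labelOrder s k)) (m+n∸m≡n (labelsUpTo s k) u)) ⟩
  leafCount earlier + leafCount (take u (current ++ rest))
    ≡⟨ cong (leafCount earlier +_) (leafCount-take-++ u current rest) ⟩
  leafCount earlier + (leafCount (take u current) + leafCount (take (u ∸ length current) rest))
    ≡⟨ cong₂ (λ m xs → m + (leafCount (take u current) + leafCount (take xs rest)))
         (leafCount-labelOrder s k) (m≤n⇒m∸n≡0 (subst (u ≤_) (sym (length-block s k)) u≤)) ⟩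
  2 ^ k + (leafCount (take u current) + 0)
    ≡⟨ cong (2 ^ k +_) (trans (+-identityʳ _) (leafCount-take-block s k u u≤)) ⟩
  2 ^ k + stageLeaves s u ∎
  where
    open ≡-Reasoning
    N       = labelsUpTo s k + u
    earlier = labelOrder s k
    current = block s (suc k)
    prefix  = labelOrder-prefix s (≤-trans (labelsUpTo-> s k) (m≤m+n (labelsUpTo s k) u))
    rest    = proj₁ prefix

2^suc : ∀ k → 2 ^ suc k ≡ 2 ^ k + 2 ^ k
2^suc k = cong (2 ^ k +_) (+-identityʳ (2 ^ k))

stageLeaves-small : ∀ s u → u ≤ suc s → stageLeaves s u ≡ 0
stageLeaves-small s u u≤ = n≤0⇒n≡0 (⌊n/2⌋-mono (subst (u ∸ s ≤_) (m+n∸n≡m 1 s) (∸-monoˡ-≤ s u≤)))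

stageLeaves-after : ∀ s j x → stageLeaves s (j + (s + x)) ≡ ⌊ (j + x) /2⌋
stageLeaves-after s j x = cong ⌊_/2⌋ (trans (cong (_∸ s) (swap j s x)) (m+n∸m≡n s (j + x)))
  where
    swap : ∀ j s x → j + (s + x) ≡ s + (j + x)
    swap = solve-∀

-- The closed form persists for one more label, the first of the next stage
-- (a super-node or level 1 node, hence not a leaf).
stage-formula⁺ : ∀ s k u → u ≤ suc (s + (2 ^ k + 2 ^ k)) →
  a s (labelsUpTo s k + u) ≡ 2 ^ k + stageLeaves s u
stage-formula⁺ s k u u≤ with m≤n⇒m<n∨m≡n u≤
... | inj₁ u<  = stage-formula s k u (≤-pred u<)
... | inj₂ refl = begin
  a s (labelsUpTo s k + suc (s + D))    ≡⟨ cong (a s) (trans (+-suc (labelsUpTo s k) (s + D)) (+-comm 1 _)) ⟩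
  a s (labelsUpTo s (suc k) + 1)        ≡⟨ stage-formula s (suc k) 1 (≤-trans (m^n>0 2 (suc k)) (≤-trans (m≤m+n _ _) (m≤n+m _ s))) ⟩
  2 ^ suc k + stageLeaves s 1           ≡⟨ cong₂ _+_ (2^suc k) (stageLeaves-small s 1 (s≤s z≤n)) ⟩
  D + 0                                 ≡⟨ +-identityʳ D ⟩
  2 ^ k + 2 ^ k                         ≡⟨ cong (2 ^ k +_) (trans (n≡⌈n+n/2⌉ (2 ^ k)) (sym (stageLeaves-after s 1 D))) ⟩
  2 ^ k + stageLeaves s (suc (s + D))   ∎
  where
    open ≡-Reasoning
    D = 2 ^ k + 2 ^ k

stageLeaves≤ : ∀ s u → stageLeaves s u ≤ u
stageLeaves≤ s u = ≤-trans (⌊n/2⌋≤n (u ∸ s)) (m∸n≤m u s)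

before-or-after : ∀ s t → t < s ⊎ ∃ λ m → s + m ≡ t
before-or-after s t with t <? s
... | yes t<s = inj₁ t<s
... | no  t≮s = inj₂ (m≤n⇒∃[o]m+o≡n (≮⇒≥ t≮s))

remove-leaves : ∀ j s m → j + (s + m) ∸ ⌊ m /2⌋ ≡ j + (s + ⌈ m /2⌉)
remove-leaves j s m = begin
  j + (s + m) ∸ ⌊ m /2⌋     ≡⟨ +-∸-assoc j (≤-trans (⌊n/2⌋≤n m) (m≤n+m m s)) ⟩
  j + (s + m ∸ ⌊ m /2⌋)     ≡⟨ cong (j +_) (+-∸-assoc s (⌊n/2⌋≤n m)) ⟩
  j + (s + (m ∸ ⌊ m /2⌋))   ≡⟨ cong (λ x → j + (s + x)) halves ⟩
  j + (s + ⌈ m /2⌉)         ∎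
  where
    open ≡-Reasoning
    halves : m ∸ ⌊ m /2⌋ ≡ ⌈ m /2⌉
    halves = trans (cong (_∸ ⌊ m /2⌋) (sym (⌊n/2⌋+⌈n/2⌉≡n m))) (m+n∸m≡n ⌊ m /2⌋ ⌈ m /2⌉)

stageLeaves-recurrence : ∀ s t →
  stageLeaves s (3 + t) ≡ stageLeaves s (3 + t ∸ stageLeaves s (2 + t)) + stageLeaves s (1 + t ∸ stageLeaves s t)
stageLeaves-recurrence s t with before-or-after s t
... | inj₁ t<s = sym (begin
  f (3 + t ∸ f (2 + t)) + f (1 + t ∸ f t)   ≡⟨ cong₂ (λ x y → f (3 + t ∸ x) + f (1 + t ∸ y))
                                                  (stageLeaves-small s (2 + t) (s≤s t<s))
                                                  (stageLeaves-small s t (≤-trans (<⇒≤ t<s) (n≤1+n s))) ⟩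
  f (3 + t) + f (1 + t)                     ≡⟨ cong (f (3 + t) +_) (stageLeaves-small s (1 + t) (≤-trans t<s (n≤1+n s))) ⟩
  f (3 + t) + 0                             ≡⟨ +-identityʳ (f (3 + t)) ⟩
  f (3 + t)                                 ∎)
  where
    open ≡-Reasoning
    f = stageLeaves s
... | inj₂ (m , refl) = sym (begin
  f (3 + (s + m) ∸ f (2 + (s + m))) + f (1 + (s + m) ∸ f (s + m))
    ≡⟨ cong₂ (λ x y → f (3 + (s + m) ∸ x) + f (1 + (s + m) ∸ y)) (stageLeaves-after s 2 m) (stageLeaves-after s 0 m) ⟩
  f (2 + (s + m) ∸ ⌊ m /2⌋) + f (1 + (s + m) ∸ ⌊ m /2⌋)
    ≡⟨ cong₂ (λ x y → f x + f y) (remove-leaves 2 s m) (remove-leaves 1 s m) ⟩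
  f (2 + (s + c)) + f (1 + (s + c))
    ≡⟨ cong₂ _+_ (stageLeaves-after s 2 c) (stageLeaves-after s 1 c) ⟩
  suc (⌊ c /2⌋ + ⌈ c /2⌉)
    ≡⟨ cong suc (⌊n/2⌋+⌈n/2⌉≡n c) ⟩
  suc c
    ≡⟨ sym (stageLeaves-after s 3 m) ⟩
  f (3 + (s + m)) ∎)
  where
    open ≡-Reasoning
    f = stageLeaves s
    c = ⌈ m /2⌉

-- After removing its leaves, a prefix of a stage of width s + 2w has at most
-- s + w labels; this keeps the recurrence's look-back inside the previous stage.
remaining-bound : ∀ s w t → t ≤ s + (w + w) → suc t ∸ stageLeaves s t ≤ suc (s + w)
remaining-bound s w t t≤ = subst (_≤ suc (s + w)) (sym (+-∸-assoc 1 (stageLeaves≤ s t))) (s≤s (bound (before-or-after s t)))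
  where
    bound : t < s ⊎ ∃ (λ m → s + m ≡ t) → t ∸ stageLeaves s t ≤ s + w
    bound (inj₁ t<s) = subst (λ x → t ∸ x ≤ s + w) (sym (stageLeaves-small s t (≤-trans (<⇒≤ t<s) (n≤1+n s))))
                         (≤-trans (<⇒≤ t<s) (m≤m+n s w))
    bound (inj₂ (m , refl)) = subst (_≤ s + w)
      (sym (trans (cong (s + m ∸_) (stageLeaves-after s 0 m)) (remove-leaves 0 s m)))
      (+-monoʳ-≤ s (subst (⌈ m /2⌉ ≤_) (sym (n≡⌈n+n/2⌉ w)) (⌈n/2⌉-mono (+-cancelˡ-≤ s m (w + w) t≤))))

RecurrenceAt : ℕ → (ℕ → ℕ) → ℕ → Set
RecurrenceAt s h n = (1 ≤ x) × (x < n) × (1 ≤ y) × (y < n) × (h n ≡ h x + h y)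
  where
    x = n ∸ s ∸ h (n ∸ 1)
    y = n ∸ 2 ∸ s ∸ h (n ∸ 3)

∸-from-sum : ∀ {x} p q → x ≡ p + q → x ∸ p ≡ q
∸-from-sum p q refl = m+n∸m≡n p q

∸-cancel-inner : ∀ x j v → x + (j + v) ∸ j ≡ x + v
∸-cancel-inner x j v = ∸-from-sum j (x + v) (swap x j v)
  where
    swap : ∀ x j v → x + (j + v) ≡ j + (x + v)
    swap = solve-∀

∸-positive : ∀ {n z} → 1 ≤ n → 1 ≤ z → n ∸ z < n
∸-positive {suc n} {suc z} _ _ = s≤s (m∸n≤m n z)

interchange : ∀ B p q → (B + B) + (p + q) ≡ (B + p) + (B + q)
interchange = solve-∀

-- Here P labels
-- precede the previous stage, which has 2B children (B = b+1 leaves before it),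
-- R = P + s + 2B labels precede the current stage, and a_s obeys the closed
-- form on both stages.
module StageRecurrence (s P b : ℕ) (1≤P : 1 ≤ P)
  (previous : ∀ v → v ≤ suc (s + (suc b + suc b)) → a s (P + v) ≡ suc b + stageLeaves s v)
  (current  : ∀ v → v ≤ s + ((suc b + suc b) + (suc b + suc b)) →
                a s (P + (s + (suc b + suc b)) + v) ≡ (suc b + suc b) + stageLeaves s v)
  where

  B C R : ℕ
  B = suc b
  C = B + B
  R = P + (s + C)

  look-back : ∀ v φ → φ ≤ v → R + v ∸ s ∸ (C + φ) ≡ P + (v ∸ φ)
  look-back v φ φ≤v = trans (∸-+-assoc (R + v) s (C + φ)) (∸-from-sum (s + (C + φ)) _ decomposition)
    where
      rearrange : ∀ P s C φ r → P + (s + C) + (φ + r) ≡ s + (C + φ) + (P + r)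
      rearrange = solve-∀
      decomposition : R + v ≡ s + (C + φ) + (P + (v ∸ φ))
      decomposition = trans (cong (R +_) (sym (m+[n∸m]≡n φ≤v))) (rearrange P s C φ (v ∸ φ))

  small-offset : ∀ {u} → u ≤ 2 → u ≤ s + C
  small-offset u≤2 = ≤-trans u≤2 (≤-trans (s≤s (≤-trans (s≤s z≤n) (m≤n+m (suc b) b))) (m≤n+m C s))

  one-back : ∀ t → t ≤ s + (C + C) → a s (R + suc t ∸ 1) ≡ C + stageLeaves s t
  one-back t t≤ = trans (cong (a s) (∸-cancel-inner R 1 t)) (current t t≤)

  closing : ∀ t x y → t ≤ s + (C + C) →
    R + suc t ∸ s ∸ a s (R + suc t ∸ 1) ≡ P + x →
    R + suc t ∸ 2 ∸ s ∸ a s (R + suc t ∸ 3) ≡ P + y →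
    a s (R + suc t) ≡ a s (P + x) + a s (P + y) →
    RecurrenceAt s (a s) (R + suc t)
  closing t x y t≤ x≡ y≡ sum≡ =
    subst (1 ≤_) (sym x≡) (≤-trans 1≤P (m≤m+n P x)) ,
    ≤-<-trans (∸-monoˡ-≤ (a s (n ∸ 1)) (m∸n≤m n s)) (∸-positive 1≤n 1≤a) ,
    subst (1 ≤_) (sym y≡) (≤-trans 1≤P (m≤m+n P y)) ,
    ≤-<-trans (≤-trans (m∸n≤m (n ∸ 2 ∸ s) (a s (n ∸ 3))) (m∸n≤m (n ∸ 2) s)) (∸-positive 1≤n (s≤s z≤n)) ,
    trans sum≡ (sym (cong₂ _+_ (cong (a s) x≡) (cong (a s) y≡)))
    where
      n = R + suc t
      1≤n : 1 ≤ n
      1≤n = subst (1 ≤_) (sym (+-suc R t)) (s≤s z≤n)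
      1≤a : 1 ≤ a s (n ∸ 1)
      1≤a = subst (1 ≤_) (sym (one-back t t≤)) (s≤s z≤n)

  -- Offsets 1 and 2: the third look-back n - 3 falls back into the previous stage.
  wrap : ∀ e → e ≤ 1 → RecurrenceAt s (a s) (R + suc e)
  wrap e e≤1 = closing e (suc e) e e≤ x≡ y≡ sum≡
    where
      f = stageLeaves s
      e≤ : e ≤ s + (C + C)
      e≤ = ≤-trans (small-offset (≤-trans e≤1 (n≤1+n 1))) (+-monoʳ-≤ s (m≤m+n C C))
      f0 : f e ≡ 0
      f0 = stageLeaves-small s e (≤-trans e≤1 (s≤s z≤n))
      x≡ : R + suc e ∸ s ∸ a s (R + suc e ∸ 1) ≡ P + suc e
      x≡ = trans (cong (λ z → R + suc e ∸ s ∸ z) (trans (one-back e e≤) (cong (C +_) f0))) (look-back (suc e) 0 z≤n)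
      three-back-offset : e + (b + b) ≤ suc (b + suc b)
      three-back-offset = +-mono-≤ e≤1 (+-monoʳ-≤ b (n≤1+n b))
      three-back : a s (R + suc e ∸ 3) ≡ B + b
      three-back = begin
        a s (R + suc e ∸ 3)             ≡⟨ cong (a s) (∸-from-sum 3 _ (shift P s b e)) ⟩
        a s (P + (s + (e + (b + b))))   ≡⟨ previous _ (≤-trans (+-monoʳ-≤ s three-back-offset) (n≤1+n _)) ⟩
        B + f (s + (e + (b + b)))       ≡⟨ cong (B +_) (stageLeaves-after s 0 (e + (b + b))) ⟩
        B + ⌊ e + (b + b) /2⌋           ≡⟨ cong (B +_) (half e e≤1) ⟩
        B + b                           ∎
        where
          open ≡-Reasoning
          shift : ∀ P s b e → P + (s + (suc b + suc b)) + suc e ≡ 3 + (P + (s + (e + (b + b))))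
          shift = solve-∀
          half : ∀ e → e ≤ 1 → ⌊ e + (b + b) /2⌋ ≡ b
          half zero       _ = sym (n≡⌊n+n/2⌋ b)
          half (suc zero) _ = sym (n≡⌈n+n/2⌉ b)
          half (suc (suc e)) (s≤s ())
      y≡ : R + suc e ∸ 2 ∸ s ∸ a s (R + suc e ∸ 3) ≡ P + e
      y≡ = begin
        R + suc e ∸ 2 ∸ s ∸ a s (R + suc e ∸ 3)   ≡⟨ cong (R + suc e ∸ 2 ∸ s ∸_) three-back ⟩
        R + suc e ∸ 2 ∸ s ∸ (B + b)               ≡⟨ ∸-+-assoc (R + suc e ∸ 2) s (B + b) ⟩
        R + suc e ∸ 2 ∸ (s + (B + b))             ≡⟨ ∸-+-assoc (R + suc e) 2 (s + (B + b)) ⟩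
        R + suc e ∸ (2 + (s + (B + b)))           ≡⟨ ∸-from-sum (2 + (s + (B + b))) (P + e) (shift P s b e) ⟩
        P + e                                     ∎
        where
          open ≡-Reasoning
          shift : ∀ P s b e → P + (s + (suc b + suc b)) + suc e ≡ 2 + (s + (suc b + b)) + (P + e)
          shift = solve-∀
      sum≡ : a s (R + suc e) ≡ a s (P + suc e) + a s (P + e)
      sum≡ = begin
        a s (R + suc e)                     ≡⟨ current (suc e) (≤-trans (small-offset (s≤s e≤1)) (+-monoʳ-≤ s (m≤m+n C C))) ⟩
        C + f (suc e)                       ≡⟨ cong (C +_) (sym (+-identityʳ (f (suc e)))) ⟩
        C + (f (suc e) + 0)                 ≡⟨ interchange B (f (suc e)) 0 ⟩
        (B + f (suc e)) + (B + 0)           ≡⟨ cong₂ _+_ (sym (previous (suc e) (≤-trans (small-offset (s≤s e≤1)) (n≤1+n _))))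
                                                         (cong (B +_) (sym f0)) ⟩
        a s (P + suc e) + (B + f e)         ≡⟨ cong (a s (P + suc e) +_) (sym (previous e (≤-trans e≤1 (s≤s z≤n)))) ⟩
        a s (P + suc e) + a s (P + e)       ∎
        where open ≡-Reasoning

  -- Offsets t + 3: all look-backs use the closed form of the current stage
  -- and land in the previous one, where stageLeaves-recurrence applies.
  generic : ∀ t → 3 + t ≤ s + (C + C) → RecurrenceAt s (a s) (R + (3 + t))
  generic t 3+t≤ = closing (2 + t) x y 2+t≤ x≡ y≡ sum≡
    where
      f = stageLeaves s
      x = 3 + t ∸ f (2 + t)
      y = 1 + t ∸ f t
      2+t≤ : 2 + t ≤ s + (C + C)
      2+t≤ = <⇒≤ 3+t≤
      t≤ : t ≤ s + (C + C)
      t≤ = ≤-trans (≤-trans (n≤1+n t) (n≤1+n (suc t))) 2+t≤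
      x≡ : R + (3 + t) ∸ s ∸ a s (R + (3 + t) ∸ 1) ≡ P + x
      x≡ = trans (cong (λ z → R + (3 + t) ∸ s ∸ z) (one-back (2 + t) 2+t≤))
                 (look-back (3 + t) (f (2 + t)) (≤-trans (stageLeaves≤ s (2 + t)) (n≤1+n _)))
      y≡ : R + (3 + t) ∸ 2 ∸ s ∸ a s (R + (3 + t) ∸ 3) ≡ P + y
      y≡ = begin
        R + (3 + t) ∸ 2 ∸ s ∸ a s (R + (3 + t) ∸ 3)   ≡⟨ cong₂ (λ m z → m ∸ s ∸ z) (∸-cancel-inner R 2 (1 + t))
                                                            (trans (cong (a s) (∸-cancel-inner R 3 t)) (current t t≤)) ⟩
        R + (1 + t) ∸ s ∸ (C + f t)                   ≡⟨ look-back (1 + t) (f t) (≤-trans (stageLeaves≤ s t) (n≤1+n t)) ⟩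
        P + y                                         ∎
        where open ≡-Reasoning
      sum≡ : a s (R + (3 + t)) ≡ a s (P + x) + a s (P + y)
      sum≡ = begin
        a s (R + (3 + t))         ≡⟨ current (3 + t) 3+t≤ ⟩
        C + f (3 + t)             ≡⟨ cong (C +_) (stageLeaves-recurrence s t) ⟩
        C + (f x + f y)           ≡⟨ interchange B (f x) (f y) ⟩
        (B + f x) + (B + f y)     ≡⟨ sym (cong₂ _+_ (previous x (remaining-bound s C (2 + t) 2+t≤))
                                                    (previous y (remaining-bound s C t t≤))) ⟩
        a s (P + x) + a s (P + y) ∎
        where open ≡-Reasoning

  recurrence : ∀ t → t < s + (C + C) → RecurrenceAt s (a s) (R + suc t)
  recurrence zero          _   = wrap 0 z≤n
  recurrence (suc zero)    _   = wrap 1 ≤-refl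
  recurrence (suc (suc t)) t< = generic t t<

stage-recurrence : ∀ s P B → 1 ≤ P → 1 ≤ B →
  (∀ v → v ≤ suc (s + (B + B)) → a s (P + v) ≡ B + stageLeaves s v) →
  (∀ v → v ≤ s + ((B + B) + (B + B)) → a s (P + (s + (B + B)) + v) ≡ (B + B) + stageLeaves s v) →
  ∀ t → t < s + ((B + B) + (B + B)) → RecurrenceAt s (a s) (P + (s + (B + B)) + suc t)
stage-recurrence s P (suc b) 1≤P _ = StageRecurrence.recurrence s P b 1≤P

stage-of : ∀ s m → ∃ λ k → ∃ λ t → (suc (suc m) ≡ labelsUpTo s k + suc t) × (t < s + (2 ^ k + 2 ^ k))
stage-of s zero = 0 , 0 , refl , ≤-trans (s≤s z≤n) (m≤n+m 2 s)
stage-of s (suc m) with stage-of s m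
... | k , t , n≡ , t< with suc t <? s + (2 ^ k + 2 ^ k)
...   | yes t+1< = k , suc t , trans (cong suc n≡) (sym (+-suc (labelsUpTo s k) (suc t))) , t+1<
...   | no  t+1≮ = suc k , 0 , next-stage , ≤-trans (m^n>0 2 (suc k)) (≤-trans (m≤m+n _ _) (m≤n+m _ s))
  where
    stage-full : suc t ≡ s + (2 ^ k + 2 ^ k)
    stage-full = ≤-antisym t< (≮⇒≥ t+1≮)
    next-stage : suc (suc (suc m)) ≡ labelsUpTo s (suc k) + 1
    next-stage = trans (cong suc (trans n≡ (cong (labelsUpTo s k +_) stage-full))) (+-comm 1 _)

a-recurrence : ∀ s n → s + 3 < n → RecurrenceAt s (a s) n
a-recurrence s zero          ()
a-recurrence s (suc zero)    s+3<1 = ⊥-elim (<⇒≱ s+3<1 (≤-trans (s≤s z≤n) (m≤n+m 3 s)))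
a-recurrence s (suc (suc m)) s+3<n with stage-of s m
... | zero , t , refl , t< = ⊥-elim (<⇒≱ s+3<n (subst (suc (suc t) ≤_) (sym (+-suc s 2)) (s≤s t<)))
... | suc k , t , n≡ , t< = subst (RecurrenceAt s (a s)) (sym n≡)
        (stage-recurrence s (labelsUpTo s k) (2 ^ k) (≤-trans (s≤s z≤n) (labelsUpTo-> s k)) (m^n>0 2 k)
          (stage-formula⁺ s k) current t (subst (λ D → t < s + (D + D)) (2^suc k) t<))
  where
    current : ∀ v → v ≤ s + ((2 ^ k + 2 ^ k) + (2 ^ k + 2 ^ k)) →
              a s (labelsUpTo s (suc k) + v) ≡ (2 ^ k + 2 ^ k) + stageLeaves s v
    current = subst (λ D → ∀ v → v ≤ s + (D + D) → a s (labelsUpTo s (suc k) + v) ≡ D + stageLeaves s v)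
                    (2^suc k) (stage-formula s (suc k))

a-initial : ∀ s n → 1 ≤ n → n ≤ s + 2 → a s n ≡ 1
a-initial s (suc u) _ n≤ = trans (stage-formula s 0 u (≤-trans (n≤1+n u) n≤))
  (cong (1 +_) (stageLeaves-small s u (≤-pred (subst (suc u ≤_) (+-comm s 2) n≤))))

a-s+3 : ∀ s → a s (s + 3) ≡ 2
a-s+3 s = trans (cong (a s) (+-suc s 2)) (trans (stage-formula s 0 (s + 2) ≤-refl) (cong (1 +_) (stageLeaves-after s 0 2)))

-- Any sequence obeying the defining equations agrees with a_s, by strong
-- induction on n: every argument the recurrence looks back to is smaller than n.
uniqueness : ∀ s h → IsHSeq s h → ∀ n → 1 ≤ n → h n ≡ a s n
uniqueness s h (h-initial , h-s+3 , h-recurrence) = <-rec (λ n → 1 ≤ n → h n ≡ a s n) step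
  where
    step : ∀ n → (∀ {m} → m < n → 1 ≤ m → h m ≡ a s m) → 1 ≤ n → h n ≡ a s n
    step n agree 1≤n with <-cmp n (s + 3)
    ... | tri< n<s+3 _ _ = trans (h-initial n 1≤n n≤s+2) (sym (a-initial s n 1≤n n≤s+2))
      where
        n≤s+2 : n ≤ s + 2
        n≤s+2 = ≤-pred (subst (suc n ≤_) (+-suc s 2) n<s+3)
    ... | tri≈ _ refl _ = trans h-s+3 (sym (a-s+3 s))
    ... | tri> _ _ s+3<n with a-recurrence s n s+3<n | h-recurrence n s+3<n
    ...   | 1≤x , x<n , 1≤y , y<n , a-sum | _ , _ , _ , _ , h-sum = begin
      h n
        ≡⟨ h-sum ⟩
      h (n ∸ s ∸ h (n ∸ 1)) + h (n ∸ 2 ∸ s ∸ h (n ∸ 3))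
        ≡⟨ cong₂ _+_ (agree-back (n ∸ s) 1 (s≤s z≤n) (∸-monoˡ-≤ 1 2≤n) 1≤x x<n)
                     (agree-back (n ∸ 2 ∸ s) 3 (s≤s z≤n) (∸-monoˡ-≤ 3 4≤n) 1≤y y<n) ⟩
      a s (n ∸ s ∸ a s (n ∸ 1)) + a s (n ∸ 2 ∸ s ∸ a s (n ∸ 3))
        ≡⟨ sym a-sum ⟩
      a s n ∎
      where
        open ≡-Reasoning
        4≤n : 4 ≤ n
        4≤n = ≤-trans (s≤s (m≤n+m 3 s)) s+3<n
        2≤n : 2 ≤ n
        2≤n = ≤-trans (s≤s (s≤s z≤n)) 4≤n
        -- h and a_s agree at n - j, hence h and a_s look back to the same place
        agree-back : ∀ c j → 1 ≤ j → 1 ≤ n ∸ j → 1 ≤ c ∸ a s (n ∸ j) → c ∸ a s (n ∸ j) < n →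
                     h (c ∸ h (n ∸ j)) ≡ a s (c ∸ a s (n ∸ j))
        agree-back c j 1≤j 1≤n∸j 1≤z z<n =
          trans (cong (λ z → h (c ∸ z)) (agree (∸-positive 1≤n 1≤j) 1≤n∸j)) (agree z<n 1≤z)

theorem2p3 : (s : ℕ) →
    IsHSeq s (a s) × (∀ (h : ℕ → ℕ) → IsHSeq s h → ∀ n → 1 ≤ n → h n ≡ a s n)
theorem2p3 s = (a-initial s , a-s+3 s , a-recurrence s) , uniqueness s
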